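{- Consider Maximum Nim with rule function $f(m)=\lfloor m/2\rfloor$, and let $\mathcal{G}(x)$ denote the Grundy number of a pile of $x\in\mathbb{Z}_{\ge 0}$ stones. Then for every $n\in\mathbb{Z}_{\ge 0}$, $$\{x\in\mathbb{Z}_{\ge 0}:\mathcal{G}(x)=n\}=\{2^k(2n+1)-1: k\in\mathbb{Z}_{\ge 0}\}.$$
   Context: Maximum Nim with rule function $f(m)=\lfloor m/2\rfloor$: there is a single pile of stones; two players alternate turns; when the pile has $m$ stones, a move removes $u$ stones with $1\le u\le \lfloor m/2\rfloor$. A player who cannot move loses. The Grundy number is defined recursively by $\mathcal{G}(x)=\mathrm{mex}\{\mathcal{G}(h): h \text{ reachable from } x \text{ in one move}\}$, where mex of a set of non-negative integers is the least non-negative integer not in it. -}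

module Defs where

open import Data.Nat using (ℕ; zero; suc; _+_; _∸_; _≤_; _<_; _≟_; _/_)
open import Data.Bool using (Bool; true; false; if_then_else_)
open import Data.List using (List; []; _∷_; length; map; upTo; drop)
open import Data.List.Membership.DecPropositional (_≟_) using (_∈?_)
open import Relation.Nullary.Decidable using (does)

f : ℕ → ℕ
f m = m / 2

-- mex of a finite list of naturals: least k not in the list.
-- The search from k upward terminates within (length xs + 1) steps.
mexSearch : ℕ → ℕ → List ℕ → ℕ
mexSearch zero    k xs = k
mexSearch (suc b) k xs = if does (k ∈? xs) then mexSearch b (suc k) xs else k

mex : List ℕ → ℕ
mex xs = mexSearch (length xs) 0 xs

options : ℕ → List ℕ
options m = map (λ i → m ∸ suc i) (upTo (f m))

-- Grundy values computed by course-of-values recursion: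
-- table n = [G 0, G 1, …, G (n-1)]
lookupD : List ℕ → ℕ → ℕ
lookupD []       _       = 0
lookupD (x ∷ xs) zero    = x
lookupD (x ∷ xs) (suc i) = lookupD xs i

snoc : List ℕ → ℕ → List ℕ
snoc []       y = y ∷ []
snoc (x ∷ xs) y = x ∷ snoc xs y

table : ℕ → List ℕ
table zero    = []
table (suc n) = snoc (table n) (mex (map (lookupD (table n)) (options n)))

G : ℕ → ℕ
G x = mex (map (lookupD (table x)) (options x))

{-# OPTIONS --safe #-}
-- Call n the class of x when x + 1 = 2^k (2n + 1). A move takes x to any h with h < x ≤ 2h.
-- Within a class the successor of h is 2h + 1, so no such window contains two members of the
-- class of x, while every class j < n has a member in it: climb the chain of j from 2j until
-- the next step would pass x. Hence, by strong induction, the Grundy values of the options of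
-- x contain every j below the class of x but not the class itself, and G x is that class.
module Submission where

open import Defs
open import Data.Nat using (ℕ; _+_; _*_; _∸_; _^_)
open import Data.Product using (∃-syntax)
open import Function.Bundles using (_⇔_)
open import Relation.Binary.PropositionalEquality using (_≡_)

open import Data.Nat using (zero; suc; pred; _≤_; _<_; z≤n; s≤s; z<s; s≤s⁻¹; _≤?_; NonZero; >-nonZero)
open import Data.Nat.Properties
open import Data.Nat.DivMod using (_/_; m*n/n≡m; m/n*n≤m; m/n≤m; /-monoˡ-≤)
open import Data.Nat.Induction using (<-rec)
open import Data.Product using (_×_; _,_; map₂)
open import Data.Sum using (_⊎_; inj₁; inj₂)
open import Data.Empty using (⊥-elim)
open import Data.List using (List; []; _∷_; length; map; upTo)
open import Data.List.Properties using (length-map; length-upTo)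
open import Data.List.Membership.Propositional using (_∈_; _∉_)
open import Data.List.Membership.Propositional.Properties using (∈-map⁺; ∈-map⁻; ∈-upTo⁺; ∈-upTo⁻)
open import Data.List.Membership.DecPropositional (Data.Nat._≟_) using (_∈?_)
open import Relation.Nullary using (yes; no)
open import Relation.Binary.PropositionalEquality using (refl; sym; trans; cong; subst; subst₂; module ≡-Reasoning)
open import Function.Bundles using (mk⇔; Equivalence)
open import Function.Properties.Equivalence using () renaming (trans to ⇔-trans)

2*m≡m+m : ∀ m → 2 * m ≡ m + m
2*m≡m+m m = cong (m +_) (+-identityʳ m)

2*[n/2]≤n : ∀ n → 2 * (n / 2) ≤ n
2*[n/2]≤n n = subst (_≤ n) (*-comm (n / 2) 2) (m/n*n≤m n 2)

2*m≤n⇒m≤n/2 : ∀ {m n} → 2 * m ≤ n → m ≤ n / 2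
2*m≤n⇒m≤n/2 {m} {n} le =
  subst (_≤ n / 2) (trans (cong (_/ 2) (*-comm 2 m)) (m*n/n≡m m 2)) (/-monoˡ-≤ 2 le)

m≤[n+m]/2⇔m≤n : ∀ m n → m ≤ (n + m) / 2 ⇔ m ≤ n
m≤[n+m]/2⇔m≤n m n = mk⇔ to from
  where
  to : m ≤ (n + m) / 2 → m ≤ n
  to le = +-cancelʳ-≤ m m n (subst (_≤ n + m) (2*m≡m+m m)
            (≤-trans (*-monoʳ-≤ 2 le) (2*[n/2]≤n (n + m))))
  from : m ≤ n → m ≤ (n + m) / 2
  from le = 2*m≤n⇒m≤n/2 (subst (_≤ n + m) (sym (2*m≡m+m m)) (+-monoˡ-≤ m le))

-- OddPart x n : x lies in class n, i.e. the odd part of x + 1 is 2n + 1.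
data OddPart : ℕ → ℕ → Set where
  even : ∀ n → OddPart (2 * n) n
  odd  : ∀ {x n} → OddPart x n → OddPart (suc (2 * x)) n

even-or-odd : ∀ x → ∃[ a ] (x ≡ 2 * a ⊎ x ≡ suc (2 * a))
even-or-odd zero = 0 , inj₁ refl
even-or-odd (suc x) with even-or-odd x
... | a , inj₁ refl = a , inj₂ refl
... | a , inj₂ refl = suc a , inj₁ (sym (*-suc 2 a))

oddPart-total : ∀ x → ∃[ n ] OddPart x n
oddPart-total = <-rec _ total
  where
  total : ∀ x → (∀ {y} → y < x → ∃[ n ] OddPart y n) → ∃[ n ] OddPart x n
  total x rec with even-or-odd x
  ... | a , inj₁ refl = a , even a
  ... | a , inj₂ refl = map₂ odd (rec (s≤s (m≤m+n a (a + 0))))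

oddPart-functional : ∀ {x y n m} → OddPart x n → OddPart y m → x ≡ y → n ≡ m
oddPart-functional (even n)      (even m)      eq = *-cancelˡ-≡ n m 2 eq
oddPart-functional (even n)      (odd {y} _)   eq = ⊥-elim (even≢odd n y eq)
oddPart-functional (odd {x} _)   (even m)      eq = ⊥-elim (even≢odd m x (sym eq))
oddPart-functional (odd {x} p)   (odd {y} q)   eq =
  oddPart-functional p q (*-cancelˡ-≡ x y 2 (suc-injective eq))

oddPart-≤ : ∀ {x n} → OddPart x n → 2 * n ≤ x
oddPart-≤ (even n)    = ≤-refl
oddPart-≤ (odd {x} p) = ≤-trans (oddPart-≤ p) (m≤n⇒m≤1+n (m≤m+n x (x + 0)))

oddPart-gap : ∀ {h x n} → OddPart h n → OddPart x n → h < x → suc (2 * h) ≤ x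
oddPart-gap (even n)     (even n)    h<x = ⊥-elim (<-irrefl refl h<x)
oddPart-gap (even n)     (odd q)     _   = s≤s (*-monoʳ-≤ 2 (oddPart-≤ q))
oddPart-gap (odd {h} p)  (even n)    h<x =
  ⊥-elim (<⇒≱ h<x (≤-trans (oddPart-≤ p) (m≤n⇒m≤1+n (m≤m+n h (h + 0)))))
oddPart-gap (odd {h} p)  (odd {x} q) (s≤s h<x) =
  s≤s (*-monoʳ-≤ 2 (oddPart-gap p q (*-cancelˡ-< 2 h x h<x)))

oddPart-climb : ∀ {h x j} → OddPart h j → h < x → ∃[ h′ ] (OddPart h′ j × h′ < x × x ≤ suc (2 * h′))
oddPart-climb {h} {x} {j} p h<x = climb x p h<x (m≤m+n x h)
  where
  climb : ∀ fuel {h} → OddPart h j → h < x → x ≤ fuel + h →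
          ∃[ h′ ] (OddPart h′ j × h′ < x × x ≤ suc (2 * h′))
  climb fuel {h} p h<x x≤ with x ≤? suc (2 * h)
  ... | yes x≤2h+1 = h , p , h<x , x≤2h+1
  climb zero        p h<x x≤h | no _ = ⊥-elim (<⇒≱ h<x x≤h)
  climb (suc fuel) {h} p _ x≤ | no x≰2h+1 =
    climb fuel (odd p) (≰⇒> x≰2h+1) (≤-trans x≤ fuel-suffices)
    where
    fuel-suffices : suc fuel + h ≤ fuel + suc (2 * h)
    fuel-suffices = ≤-trans (s≤s (+-monoʳ-≤ fuel (m≤m+n h (h + 0))))
                            (≤-reflexive (sym (+-suc fuel (2 * h))))

oddPart⇒power : ∀ {x n} → OddPart x n → ∃[ k ] suc x ≡ 2 ^ k * suc (2 * n)
oddPart⇒power (even n) = 0 , sym (+-identityʳ _)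
oddPart⇒power (odd {x} {n} p) with oddPart⇒power p
... | k , e = suc k , (begin
  suc (suc (2 * x))          ≡⟨ *-suc 2 x ⟨
  2 * suc x                  ≡⟨ cong (2 *_) e ⟩
  2 * (2 ^ k * suc (2 * n))  ≡⟨ *-assoc 2 (2 ^ k) _ ⟨
  2 ^ suc k * suc (2 * n)    ∎)
  where open ≡-Reasoning

2^k*[1+m]≢0 : ∀ k m → NonZero (2 ^ k * suc m)
2^k*[1+m]≢0 k m = m*n≢0 (2 ^ k) (suc m) {{m^n≢0 2 k}}

power⇒oddPart : ∀ {x n} k → suc x ≡ 2 ^ k * suc (2 * n) → OddPart x n
power⇒oddPart {n = n} zero e =
  subst (λ y → OddPart y n) (sym (suc-injective (trans e (+-identityʳ _)))) (even n)
power⇒oddPart {x} {n} (suc k) e =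
  subst (λ y → OddPart y n) (sym x≡) (odd (power⇒oddPart k (suc-pred p)))
  where
  open ≡-Reasoning
  p : ℕ
  p = 2 ^ k * suc (2 * n)
  instance
    p≢0 : NonZero p
    p≢0 = 2^k*[1+m]≢0 k (2 * n)
  x≡ : x ≡ suc (2 * pred p)
  x≡ = suc-injective (begin
    suc x                   ≡⟨ e ⟩
    2 ^ suc k * suc (2 * n) ≡⟨ *-assoc 2 (2 ^ k) _ ⟩
    2 * p                   ≡⟨ cong (2 *_) (suc-pred p) ⟨
    2 * suc (pred p)        ≡⟨ *-suc 2 (pred p) ⟩
    suc (suc (2 * pred p))  ∎)

≡∸1⇔suc≡ : ∀ {x} y .{{_ : NonZero y}} → x ≡ y ∸ 1 ⇔ suc x ≡ y
≡∸1⇔suc≡ (suc y) = mk⇔ (cong suc) suc-injective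

oddPart⇔power : ∀ {x n} → OddPart x n ⇔ (∃[ k ] x ≡ 2 ^ k * (2 * n + 1) ∸ 1)
oddPart⇔power {n = n} rewrite +-comm (2 * n) 1 = mk⇔
  (λ p → map₂ (λ {k} → from (≡∸1⇔suc≡ _ {{2^k*[1+m]≢0 k (2 * n)}})) (oddPart⇒power p))
  (λ (k , e) → power⇒oddPart k (to (≡∸1⇔suc≡ _ {{2^k*[1+m]≢0 k (2 * n)}}) e))
  where open Equivalence

mexSearch-≡ : ∀ {v} {xs : List ℕ} b k → k ≤ v → v ≤ b + k →
              (∀ {j} → k ≤ j → j < v → j ∈ xs) → v ∉ xs → mexSearch b k xs ≡ v
mexSearch-≡ zero k k≤v v≤k _ _ = ≤-antisym k≤v v≤k
mexSearch-≡ {v} {xs} (suc b) k k≤v v≤ below v∉ with k ∈? xs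
... | yes k∈ = mexSearch-≡ b (suc k) (≤∧≢⇒< k≤v λ { refl → v∉ k∈ })
                 (≤-trans v≤ (≤-reflexive (sym (+-suc b k))))
                 (λ k<j → below (<⇒≤ k<j)) v∉
... | no k∉ = ≤-antisym k≤v (≮⇒≥ λ k<v → k∉ (below ≤-refl k<v))

mex-≡ : ∀ {v} {xs : List ℕ} → v ≤ length xs → (∀ {j} → j < v → j ∈ xs) → v ∉ xs → mex xs ≡ v
mex-≡ {xs = xs} v≤ below v∉ =
  mexSearch-≡ (length xs) 0 z≤n (≤-trans v≤ (m≤m+n _ 0)) (λ _ → below) v∉

length-snoc : ∀ xs (y : ℕ) → length (snoc xs y) ≡ suc (length xs)
length-snoc []       y = refl
length-snoc (x ∷ xs) y = cong suc (length-snoc xs y)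

lookupD-snoc-< : ∀ xs y {i} → i < length xs → lookupD (snoc xs y) i ≡ lookupD xs i
lookupD-snoc-< (x ∷ xs) y {zero}  _         = refl
lookupD-snoc-< (x ∷ xs) y {suc i} (s≤s i<n) = lookupD-snoc-< xs y i<n

lookupD-snoc-length : ∀ xs y → lookupD (snoc xs y) (length xs) ≡ y
lookupD-snoc-length []       y = refl
lookupD-snoc-length (x ∷ xs) y = lookupD-snoc-length xs y

length-table : ∀ n → length (table n) ≡ n
length-table zero    = refl
length-table (suc n) = trans (length-snoc (table n) _) (cong suc (length-table n))

lookupD-table : ∀ {x h} → h < x → lookupD (table x) h ≡ G h
lookupD-table {suc x} {h} (s≤s h≤x) with m≤n⇒m<n∨m≡n h≤x
... | inj₁ h<x = trans (lookupD-snoc-< (table x) _ (subst (h <_) (sym (length-table x)) h<x))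
                       (lookupD-table h<x)
... | inj₂ refl = subst (λ i → lookupD (table (suc h)) i ≡ G h) (length-table h)
                        (lookupD-snoc-length (table h) _)

∈-options⁻ : ∀ {x h} → h ∈ options x → h < x × x ≤ 2 * h
∈-options⁻ {x} h∈ with ∈-map⁻ (λ i → x ∸ suc i) h∈
... | i , i∈ , refl = ∸-monoʳ-< z<s u≤x , x≤2h
  where
  u≤x/2 : suc i ≤ x / 2
  u≤x/2 = ∈-upTo⁻ i∈
  u≤x : suc i ≤ x
  u≤x = ≤-trans u≤x/2 (m/n≤m x 2)
  h+u≡x : x ∸ suc i + suc i ≡ x
  h+u≡x = m∸n+n≡m u≤x
  u≤h : suc i ≤ x ∸ suc i
  u≤h = Equivalence.to (m≤[n+m]/2⇔m≤n (suc i) (x ∸ suc i))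
          (subst (λ y → suc i ≤ y / 2) (sym h+u≡x) u≤x/2)
  x≤2h : x ≤ 2 * (x ∸ suc i)
  x≤2h = subst₂ _≤_ h+u≡x (sym (2*m≡m+m (x ∸ suc i))) (+-monoʳ-≤ (x ∸ suc i) u≤h)

∈-options⁺ : ∀ {x h} → h < x → x ≤ 2 * h → h ∈ options x
∈-options⁺ {x} {h} h<x x≤2h =
  subst (_∈ options x) x∸u≡h (∈-map⁺ (λ i → x ∸ suc i) (∈-upTo⁺ pred-u<x/2))
  where
  u : ℕ
  u = x ∸ h
  suc-pred-u : suc (pred u) ≡ u
  suc-pred-u = suc-pred u {{>-nonZero (m<n⇒0<n∸m h<x)}}
  h+u≡x : h + u ≡ x
  h+u≡x = m+[n∸m]≡n (<⇒≤ h<x)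
  u≤h : u ≤ h
  u≤h = +-cancelˡ-≤ h u h (subst₂ _≤_ (sym h+u≡x) (2*m≡m+m h) x≤2h)
  pred-u<x/2 : pred u < x / 2
  pred-u<x/2 = subst₂ (λ a b → a ≤ b / 2) (sym suc-pred-u) h+u≡x
               (Equivalence.from (m≤[n+m]/2⇔m≤n u h) u≤h)
  x∸u≡h : x ∸ suc (pred u) ≡ h
  x∸u≡h = trans (cong (x ∸_) suc-pred-u) (m∸[m∸n]≡n (<⇒≤ h<x))

optionGrundies : ℕ → List ℕ
optionGrundies x = map (lookupD (table x)) (options x)

length-optionGrundies : ∀ x → length (optionGrundies x) ≡ x / 2
length-optionGrundies x = trans (length-map _ (options x))
  (trans (length-map (λ i → x ∸ suc i) (upTo (x / 2))) (length-upTo (x / 2)))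

∈-optionGrundies⁺ : ∀ {x h} → h < x → x ≤ 2 * h → G h ∈ optionGrundies x
∈-optionGrundies⁺ {x} h<x x≤2h =
  subst (_∈ optionGrundies x) (lookupD-table h<x)
        (∈-map⁺ (lookupD (table x)) (∈-options⁺ h<x x≤2h))

∈-optionGrundies⁻ : ∀ {x k} → k ∈ optionGrundies x → ∃[ h ] (h < x × x ≤ 2 * h × G h ≡ k)
∈-optionGrundies⁻ {x} k∈ with ∈-map⁻ (lookupD (table x)) k∈
... | h , h∈ , refl with ∈-options⁻ h∈
... | h<x , x≤2h = h , h<x , x≤2h , sym (lookupD-table h<x)

oddPart⇒G≡ : ∀ {x n} → (∀ {h} → h < x → OddPart h (G h)) → OddPart x n → G x ≡ n
oddPart⇒G≡ {x} {n} ih p = mex-≡ n≤length reaches avoids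
  where
  n≤length : n ≤ length (optionGrundies x)
  n≤length = subst (n ≤_) (sym (length-optionGrundies x)) (2*m≤n⇒m≤n/2 (oddPart-≤ p))
  reaches : ∀ {j} → j < n → j ∈ optionGrundies x
  reaches {j} j<n with oddPart-climb (even j) (<-≤-trans (*-monoʳ-< 2 j<n) (oddPart-≤ p))
  ... | h , q , h<x , x≤2h+1 with m≤n⇒m<n∨m≡n x≤2h+1
  ...   | inj₂ refl = ⊥-elim (<-irrefl (oddPart-functional (odd q) p refl) j<n)
  ...   | inj₁ x≤2h =
    subst (_∈ optionGrundies x) (oddPart-functional (ih h<x) q refl)
          (∈-optionGrundies⁺ h<x (s≤s⁻¹ x≤2h))
  avoids : n ∉ optionGrundies x
  avoids n∈ with ∈-optionGrundies⁻ n∈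
  ... | h , h<x , x≤2h , refl = <⇒≱ (oddPart-gap (ih h<x) p h<x) x≤2h

grundy-oddPart : ∀ x → OddPart x (G x)
grundy-oddPart = <-rec _ λ x ih →
  let n , p = oddPart-total x in subst (OddPart x) (sym (oddPart⇒G≡ ih p)) p

G≡⇔oddPart : ∀ {n x} → G x ≡ n ⇔ OddPart x n
G≡⇔oddPart {n} {x} = mk⇔ (λ { refl → grundy-oddPart x })
                         (λ p → oddPart-functional (grundy-oddPart x) p refl)

lemma2p3 : (n x : ℕ) → (G x ≡ n) ⇔ (∃[ k ] x ≡ 2 ^ k * (2 * n + 1) ∸ 1)
lemma2p3 n x = ⇔-trans G≡⇔oddPart oddPart⇔power
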